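{- Let $\lambda$ be a partition of an integer $n\ge3$ and $\lambda^t$ its conjugate. Then $\widehat{M}_{n-2}(\lambda)=\widehat{M}_{n-2}(\lambda^t)$ if and only if $\widehat{M}_{n-3}(\lambda)=\widehat{M}_{n-3}(\lambda^t)$.
   Context: The conjugate $\lambda^t$ has $i$-th part equal to the number of cells in the $i$-th column of $\lambda$. For $\lambda\vdash n$ and $0\le k\le n$, a $k$-minor of $\lambda$ is a partition $\mu\vdash n-k$ with $\mu_i\le\lambda_i$ for all $i$; $\widehat{M}_k(\lambda)$ is the multiset of $k$-minors $\mu$ of $\lambda$ with multiplicity equal to the number $N(\lambda/\mu)$ of standard Young tableaux of skew shape $\lambda/\mu$. -}

module Defs where

open import Data.Nat using (ℕ; zero; suc; _+_; _∸_; _≤ᵇ_; _<ᵇ_; _≡ᵇ_)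
open import Data.Bool using (Bool; true; false; _∧_; if_then_else_)
open import Data.List using (List; []; _∷_; map; length; filter; _++_)
open import Data.Nat.ListAction using (sum)
open import Data.Nat using (_≤?_)
open import Relation.Binary.PropositionalEquality using (_≡_)

isPartition : List ℕ → Bool
isPartition [] = true
isPartition (a ∷ []) = 1 ≤ᵇ a
isPartition (a ∷ b ∷ l) = (b ≤ᵇ a) ∧ isPartition (b ∷ l)

size : List ℕ → ℕ
size = sum

head0 : List ℕ → ℕ
head0 [] = 0
head0 (a ∷ _) = a

oneTo : ℕ → List ℕ
oneTo zero = []
oneTo (suc m) = oneTo m ++ (suc m ∷ [])

-- conjugate: i-th part = number of cells in column i = #{ j : λⱼ ≥ i }, i = 1..λ₁
conj : List ℕ → List ℕ
conj λ′ = map (λ i → length (filter (λ a → i ≤? a) λ′)) (oneTo (head0 λ′))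

-- μᵢ ≤ λᵢ for all i (parts beyond the length count as 0)
contained : List ℕ → List ℕ → Bool
contained [] _ = true
contained (a ∷ m) [] = (a ≡ᵇ 0) ∧ contained m []
contained (a ∷ m) (b ∷ l) = (a ≤ᵇ b) ∧ contained m l

eqL : List ℕ → List ℕ → Bool
eqL [] [] = true
eqL (a ∷ m) (b ∷ l) = (a ≡ᵇ b) ∧ eqL m l
eqL _ _ = false

-- x ∷ r, but dropping a trailing zero part
cons′ : ℕ → List ℕ → List ℕ
cons′ zero [] = []
cons′ x r = x ∷ r

-- all partitions obtained from a partition by removing one corner cell
removals : List ℕ → List (List ℕ)
removals [] = []
removals (a ∷ r) =
  (if head0 r <ᵇ a then cons′ (a ∸ 1) r ∷ [] else []) ++ map (a ∷_) (removals r)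

-- Number of standard Young tableaux of skew shape λ/μ, counted as the number
-- of saturated chains μ = ν⁰ ⊂ ν¹ ⊂ … ⊂ νᵐ = λ of partitions, each step adding
-- one cell (the cell holding the largest entry is removed first).
-- The fuel argument bounds the chain length; |λ| fuel always suffices.
sytFuel : ℕ → List ℕ → List ℕ → ℕ
sytFuel f λ′ μ with eqL λ′ μ
... | true = 1
sytFuel zero λ′ μ | false = 0
sytFuel (suc f) λ′ μ | false =
  sum (map (λ ν → if contained μ ν then sytFuel f ν μ else 0) (removals λ′))

N : List ℕ → List ℕ → ℕ
N λ′ μ = sytFuel (size λ′) λ′ μ

-- multiplicity of μ in the multiset M̂ₖ(λ) of k-minors of λ ⊢ n:
-- N(λ/μ) if μ is a partition of n − k with μᵢ ≤ λᵢ for all i, and 0 otherwise.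
minorMult : ℕ → List ℕ → List ℕ → ℕ
minorMult k λ′ μ =
  if isPartition μ ∧ (size μ ≡ᵇ (size λ′ ∸ k)) ∧ contained μ λ′
  then N λ′ μ else 0

MinorsEq : ℕ → List ℕ → List ℕ → Set
MinorsEq k λ′ ρ = (μ : List ℕ) → minorMult k λ′ μ ≡ minorMult k ρ μ

module Submission where

-- Write skew λ ν for N(λ/ν) when ν ⊆ λ (and 0 otherwise). The minors of size 2
-- are (2), (1,1) and those of size 3 are (3), (2,1), (1,1,1), so both equalities
-- are statements about five values of skew. Two facts relate these values.
--  * Conjugation invariance: skew λᵗ νᵗ = skew λ ν, because conjugation is an
--    automorphism of Young's lattice; it exchanges (3) and (1,1,1) and fixes (2,1).
--  * Branching: removing the cell holding the largest entry of a tableau gives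
--    skew λ ν = Σ skew κ ν over the partitions κ covered by λ, when |ν| < |λ|.
--    Hence the relations skew λ (2) = skew λ (3) + skew λ (2,1) and
--    skew λ (1,1) = skew λ (2,1) + skew λ (1,1,1), checked on partitions of 3,
--    hold for every λ with |λ| ≥ 3.
-- Consequently each side of the equivalence says N(λ/(3)) = N(λ/(1,1,1)).

open import Defs
open import Data.Nat using (ℕ; zero; suc; _+_; _∸_; _≤_; _<_; _<ᵇ_; _≡ᵇ_; _≤?_; _<?_; z≤n; s≤s)
open import Data.Nat.Properties
open import Data.Bool using (true; false; T; _∧_; if_then_else_)
open import Data.Bool.Properties using (T-∧; T-≡)
open import Data.Unit using (tt)
open import Data.Empty using (⊥-elim)
open import Data.Product using (_×_; _,_; proj₁; proj₂)
open import Data.Sum using (_⊎_; inj₁; inj₂)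
open import Data.List using (List; []; _∷_; _++_; map; length; filter)
open import Data.List.Properties
  using (∷-injectiveʳ; length-++; length-map; map-++; map-∘; map-id-local; map-cong-local; filter-accept; filter-reject)
open import Data.List.Membership.Propositional using (_∈_)
open import Data.List.Membership.Propositional.Properties using (∈-++⁺ʳ; ∈-map⁺; ∈-map⁻)
open import Data.List.Relation.Unary.Any using (here; there)
open import Data.List.Relation.Unary.All as All using (All)
open import Data.List.Relation.Unary.Unique.Propositional using (Unique)
open import Data.List.Relation.Unary.AllPairs using ([]; _∷_)
import Data.List.Relation.Unary.Unique.Propositional.Properties as Unique
open import Data.Nat.ListAction using (sum)
open import Data.Nat.ListAction.Properties using (sum-++; sum-↭)
open import Data.List.Relation.Binary.Permutation.Propositional using (_↭_)
import Data.List.Relation.Binary.Permutation.Propositional.Properties as Perm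
open import Data.List.Relation.Binary.BagAndSetEquality using (∼bag⇒↭)
open import Data.List.Membership.Propositional.Properties.WithK using (unique∧set⇒bag)
open import Function.Base using (_∘_)
open import Function.Properties.Equivalence using () renaming (trans to ⇔-trans; sym to ⇔-sym)
open import Algebra.Properties.CommutativeSemigroup +-commutativeSemigroup using (interchange)
open import Function.Bundles using (_⇔_; mk⇔; Equivalence)
open import Relation.Binary.PropositionalEquality
open import Relation.Nullary using (yes; no; ¬_)

∧-elim : ∀ {a b} → T (a ∧ b) → T a × T b
∧-elim = Equivalence.to T-∧

∧-intro : ∀ {a b} → T a → T b → T (a ∧ b)
∧-intro p q = Equivalence.from T-∧ (p , q)

true⇒T : ∀ {b} → b ≡ true → T b
true⇒T = Equivalence.from T-≡

T-ext : ∀ {a b} → (T a → T b) → (T b → T a) → a ≡ b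
T-ext {false} {false} _ _ = refl
T-ext {false} {true}  _ g = ⊥-elim (g tt)
T-ext {true}  {false} f _ = ⊥-elim (f tt)
T-ext {true}  {true}  _ _ = refl

≤-by-elements : ∀ a b → (∀ k → k < a → k < b) → a ≤ b
≤-by-elements a b h with a ≤? b
... | yes a≤b = a≤b
... | no a≰b  = ⊥-elim (<-irrefl refl (h b (≰⇒> a≰b)))

sum-map-+ : ∀ {A : Set} (f g : A → ℕ) xs →
  sum (map (λ x → f x + g x) xs) ≡ sum (map f xs) + sum (map g xs)
sum-map-+ f g []       = refl
sum-map-+ f g (x ∷ xs) =
  trans (cong (f x + g x +_) (sum-map-+ f g xs)) (interchange (f x) (g x) _ _)

sum-map-1 : ∀ {A : Set} (xs : List A) → sum (map (λ _ → 1) xs) ≡ length xs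
sum-map-1 []       = refl
sum-map-1 (_ ∷ xs) = cong suc (sum-map-1 xs)

sum-map-0 : ∀ {A : Set} (xs : List A) → sum (map (λ _ → 0) xs) ≡ 0
sum-map-0 []       = refl
sum-map-0 (_ ∷ xs) = sum-map-0 xs

-- part l i is the (i+1)-st part of l; parts beyond the length are 0.
part : List ℕ → ℕ → ℕ
part []      _       = 0
part (a ∷ _) zero    = a
part (_ ∷ r) (suc i) = part r i

part-zero : ∀ l → part l 0 ≡ head0 l
part-zero []      = refl
part-zero (_ ∷ _) = refl

record IsPart (l : List ℕ) : Set where
  field
    decreasing : ∀ i → part l (suc i) ≤ part l i
    positive   : ∀ i → i < length l → 0 < part l i
open IsPart

IsPart-tail : ∀ {a r} → IsPart (a ∷ r) → IsPart r
IsPart-tail p = record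
  { decreasing = λ i → decreasing p (suc i)
  ; positive   = λ i i< → positive p (suc i) (s≤s i<) }

IsPart-[] : IsPart []
IsPart-[] = record { decreasing = λ _ → z≤n ; positive = λ _ () }

part≤head : ∀ {l} → IsPart l → ∀ i → part l i ≤ head0 l
part≤head {[]}    _ _       = z≤n
part≤head {_ ∷ _} _ zero    = ≤-refl
part≤head {_ ∷ _} p (suc i) = ≤-trans (decreasing p i) (part≤head p i)

IsPart-cons : ∀ {a b l} → b ≤ a → IsPart (b ∷ l) → IsPart (a ∷ b ∷ l)
IsPart-cons {a} {b} {l} b≤a p = record { decreasing = dec ; positive = pos }
  where
  dec : ∀ i → part (a ∷ b ∷ l) (suc i) ≤ part (a ∷ b ∷ l) i
  dec zero    = b≤a
  dec (suc i) = decreasing p i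
  pos : ∀ i → i < length (a ∷ b ∷ l) → 0 < part (a ∷ b ∷ l) i
  pos zero    _        = ≤-trans (positive p 0 (s≤s z≤n)) b≤a
  pos (suc i) (s≤s i<) = positive p i i<

isPartition⇒IsPart : ∀ l → T (isPartition l) → IsPart l
isPartition⇒IsPart [] _ = IsPart-[]
isPartition⇒IsPart (a ∷ []) t = record
  { decreasing = λ _ → z≤n
  ; positive   = λ { zero _ → ≤ᵇ⇒≤ 1 a t ; (suc _) (s≤s ()) } }
isPartition⇒IsPart (a ∷ b ∷ l) t =
  IsPart-cons (≤ᵇ⇒≤ b a (proj₁ (∧-elim t))) (isPartition⇒IsPart (b ∷ l) (proj₂ (∧-elim t)))

IsPart⇒isPartition : ∀ l → IsPart l → T (isPartition l)
IsPart⇒isPartition []          _ = tt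
IsPart⇒isPartition (a ∷ [])    p = ≤⇒≤ᵇ (positive p 0 (s≤s z≤n))
IsPart⇒isPartition (a ∷ b ∷ l) p =
  ∧-intro (≤⇒≤ᵇ (decreasing p 0)) (IsPart⇒isPartition (b ∷ l) (IsPart-tail p))

part-ext : ∀ x y → IsPart x → IsPart y → (∀ i → part x i ≡ part y i) → x ≡ y
part-ext []      []      _  _  _ = refl
part-ext []      (_ ∷ _) _  py e = ⊥-elim (<-irrefl (e 0) (positive py 0 (s≤s z≤n)))
part-ext (_ ∷ _) []      px _  e = ⊥-elim (<-irrefl (sym (e 0)) (positive px 0 (s≤s z≤n)))
part-ext (a ∷ m) (b ∷ l) px py e =
  cong₂ _∷_ (e 0) (part-ext m l (IsPart-tail px) (IsPart-tail py) (λ i → e (suc i)))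

contained⇒≤ : ∀ x y → T (contained x y) → ∀ i → part x i ≤ part y i
contained⇒≤ []      _       _ _       = z≤n
contained⇒≤ (a ∷ m) []      t zero    = ≤-reflexive (≡ᵇ⇒≡ a 0 (proj₁ (∧-elim t)))
contained⇒≤ (a ∷ m) []      t (suc i) = contained⇒≤ m [] (proj₂ (∧-elim t)) i
contained⇒≤ (a ∷ m) (b ∷ l) t zero    = ≤ᵇ⇒≤ a b (proj₁ (∧-elim t))
contained⇒≤ (a ∷ m) (b ∷ l) t (suc i) = contained⇒≤ m l (proj₂ (∧-elim t)) i

≤⇒contained : ∀ x y → (∀ i → part x i ≤ part y i) → T (contained x y)
≤⇒contained []      _       _ = tt
≤⇒contained (a ∷ m) []      h =
  ∧-intro (≡⇒≡ᵇ a 0 (n≤0⇒n≡0 (h 0))) (≤⇒contained m [] (λ i → h (suc i)))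
≤⇒contained (a ∷ m) (b ∷ l) h =
  ∧-intro (≤⇒≤ᵇ (h 0)) (≤⇒contained m l (λ i → h (suc i)))

contained-trans : ∀ x y z → T (contained x y) → T (contained y z) → T (contained x z)
contained-trans x y z p q =
  ≤⇒contained x z (λ i → ≤-trans (contained⇒≤ x y p i) (contained⇒≤ y z q i))

contained-size : ∀ x y → T (contained x y) → size x ≤ size y
contained-size []      _       _ = z≤n
contained-size (a ∷ m) []      t rewrite ≡ᵇ⇒≡ a 0 (proj₁ (∧-elim t)) =
  contained-size m [] (proj₂ (∧-elim t))
contained-size (a ∷ m) (b ∷ l) t =
  +-mono-≤ (≤ᵇ⇒≤ a b (proj₁ (∧-elim t))) (contained-size m l (proj₂ (∧-elim t)))

contained-same-size : ∀ x y → IsPart x → IsPart y → T (contained x y) → size x ≡ size y → x ≡ y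
contained-same-size [] [] _ _ _ _ = refl
contained-same-size [] (b ∷ l) _ py _ e =
  ⊥-elim (<-irrefl e (≤-trans (positive py 0 (s≤s z≤n)) (m≤m+n b (sum l))))
contained-same-size (a ∷ m) [] px _ t _ =
  ⊥-elim (<-irrefl (sym (≡ᵇ⇒≡ a 0 (proj₁ (∧-elim t)))) (positive px 0 (s≤s z≤n)))
contained-same-size (a ∷ m) (b ∷ l) px py t e =
  cong₂ _∷_ a≡b (contained-same-size m l (IsPart-tail px) (IsPart-tail py) m⊆l tails)
  where
  m⊆l = proj₂ (∧-elim t)
  a≡b : a ≡ b
  a≡b = ≤-antisym (≤ᵇ⇒≤ a b (proj₁ (∧-elim t)))
    (+-cancelʳ-≤ (sum m) b a (≤-trans (+-monoʳ-≤ b (contained-size m l m⊆l)) (≤-reflexive (sym e))))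
  tails : sum m ≡ sum l
  tails = +-cancelˡ-≡ a (sum m) (sum l) (trans e (cong (_+ sum l) (sym a≡b)))

eqL⇒≡ : ∀ x y → T (eqL x y) → x ≡ y
eqL⇒≡ []      []      _ = refl
eqL⇒≡ (a ∷ m) (b ∷ l) t = cong₂ _∷_ (≡ᵇ⇒≡ a b (proj₁ (∧-elim t))) (eqL⇒≡ m l (proj₂ (∧-elim t)))

eqL-refl : ∀ x → T (eqL x x)
eqL-refl []      = tt
eqL-refl (a ∷ m) = ∧-intro (≡⇒≡ᵇ a a refl) (eqL-refl m)

record _⋖_ (κ l : List ℕ) : Set where
  constructor covered
  field
    isPart   : IsPart κ
    ⊆-upper  : T (contained κ l)
    one-more : size l ≡ suc (size κ)

remove-first : ∀ a r → IsPart (a ∷ r) → head0 r < a → cons′ (a ∸ 1) r ⋖ (a ∷ r)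
remove-first 1 [] _ _ = covered IsPart-[] tt refl
remove-first 1 (b ∷ r) p (s≤s b≤0) =
  ⊥-elim (<-irrefl (sym (n≤0⇒n≡0 b≤0)) (positive p 1 (s≤s (s≤s z≤n))))
remove-first (suc (suc a)) r p (s≤s h≤a) =
  covered q (≤⇒contained (suc a ∷ r) (suc (suc a) ∷ r) shorter) refl
  where
  q : IsPart (suc a ∷ r)
  q = record
    { decreasing = λ { zero → subst (_≤ suc a) (sym (part-zero r)) h≤a
                     ; (suc i) → decreasing p (suc i) }
    ; positive   = λ { zero _ → s≤s z≤n ; (suc i) i< → positive p (suc i) i< } }
  shorter : ∀ i → part (suc a ∷ r) i ≤ part (suc (suc a) ∷ r) i
  shorter zero    = n≤1+n (suc a)
  shorter (suc i) = ≤-refl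

remove-later : ∀ {a r κ} → IsPart (a ∷ r) → κ ⋖ r → (a ∷ κ) ⋖ (a ∷ r)
remove-later {a} {r} {κ} p (covered q κ⊆r sr) =
  covered q′ (∧-intro (≤⇒≤ᵇ (≤-refl {a})) κ⊆r) (trans (cong (a +_) sr) (+-suc a (size κ)))
  where
  q′ : IsPart (a ∷ κ)
  q′ = record
    { decreasing = λ { zero → ≤-trans (contained⇒≤ κ r κ⊆r 0) (part≤head p 1)
                     ; (suc i) → decreasing q i }
    ; positive   = λ { zero _ → positive p 0 (s≤s z≤n) ; (suc i) (s≤s i<) → positive q i i< } }

removals-sound : ∀ l → IsPart l → ∀ {κ} → κ ∈ removals l → κ ⋖ l
removals-sound (a ∷ r) p m with head0 r <ᵇ a in lt
removals-sound (a ∷ r) p m          | false with ∈-map⁻ (a ∷_) m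
... | κ′ , m′ , refl = remove-later p (removals-sound r (IsPart-tail p) m′)
removals-sound (a ∷ r) p (here refl) | true =
  remove-first a r p (<ᵇ⇒< (head0 r) a (true⇒T lt))
removals-sound (a ∷ r) p (there m)  | true with ∈-map⁻ (a ∷_) m
... | κ′ , m′ , refl = remove-later p (removals-sound r (IsPart-tail p) m′)

removals-first : ∀ c r → 0 < c → head0 r ≤ c → (c ∷ r) ∈ removals (suc c ∷ r)
removals-first (suc c) r _ h≤c with head0 r <ᵇ suc (suc c) in lt
... | true  = here refl
... | false = ⊥-elim (subst T lt (<⇒<ᵇ (s≤s h≤c)))

removals-later : ∀ a r {κ} → κ ∈ removals r → (a ∷ κ) ∈ removals (a ∷ r)
removals-later a r m = ∈-++⁺ʳ _ (∈-map⁺ (a ∷_) m)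

⋖-tail : ∀ {a κ r} → (a ∷ κ) ⋖ (a ∷ r) → κ ⋖ r
⋖-tail {a} {κ} (covered q ⊆ e) =
  covered (IsPart-tail q) (proj₂ (∧-elim ⊆)) (+-cancelˡ-≡ a _ _ (trans e (sym (+-suc a (size κ)))))

cover-first-row : ∀ {a c r κ} → IsPart (a ∷ r) → (c ∷ κ) ⋖ (a ∷ r) → c ≢ a → κ ≡ r × a ≡ suc c
cover-first-row {a} {c} {r} {κ} p (covered q ⊆ e) c≢a = κ≡r , a≡1+c
  where
  c<a : c < a
  c<a = ≤∧≢⇒< (≤ᵇ⇒≤ c a (proj₁ (∧-elim ⊆))) c≢a
  κ⊆r = proj₂ (∧-elim ⊆)
  sizes : size κ ≡ size r
  sizes = ≤-antisym (contained-size κ r κ⊆r)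
    (+-cancelˡ-≤ a _ _ (≤-trans (≤-reflexive e) (+-monoˡ-≤ (size κ) c<a)))
  κ≡r : κ ≡ r
  κ≡r = contained-same-size κ r (IsPart-tail q) (IsPart-tail p) κ⊆r sizes
  a≡1+c : a ≡ suc c
  a≡1+c = +-cancelʳ-≡ (size r) a (suc c) (trans e (cong (λ z → suc (c + z)) sizes))

removals-complete : ∀ l → IsPart l → ∀ {κ} → κ ⋖ l → κ ∈ removals l
removals-complete [] _ (covered _ _ ())
removals-complete (zero ∷ r) p {[]} _ = ⊥-elim (<-irrefl refl (positive p 0 (s≤s z≤n)))
removals-complete (1 ∷ []) _ {[]} _ = here refl
removals-complete (1 ∷ b ∷ r) p {[]} (covered _ _ e) =
  ⊥-elim (<-irrefl (sym (m+n≡0⇒m≡0 b (suc-injective e))) (positive p 1 (s≤s (s≤s z≤n))))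
removals-complete (suc (suc a) ∷ r) _ {[]} (covered _ _ ())
removals-complete (a ∷ r) p {c ∷ κ} cov@(covered q _ _) with c ≟ a
... | yes refl = removals-later c r (removals-complete r (IsPart-tail p) (⋖-tail cov))
... | no c≢a with cover-first-row p cov c≢a
...   | refl , refl =
  removals-first c r (positive q 0 (s≤s z≤n)) (subst (_≤ c) (part-zero r) (decreasing q 0))

shortened≢ : ∀ a r {κ} → 0 < a → cons′ (a ∸ 1) r ≢ a ∷ κ
shortened≢ 1 []      _ ()
shortened≢ 1 (_ ∷ _) _ ()
shortened≢ (suc (suc a)) r _ ()

removals-unique : ∀ l → Unique (removals l)
removals-unique [] = []
removals-unique (a ∷ r) with head0 r <ᵇ a in lt
... | false = Unique.map⁺ ∷-injectiveʳ (removals-unique r)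
... | true  = All.tabulate first≢later ∷ Unique.map⁺ ∷-injectiveʳ (removals-unique r)
  where
  first≢later : ∀ {x} → x ∈ map (a ∷_) (removals r) → cons′ (a ∸ 1) r ≢ x
  first≢later m with ∈-map⁻ (a ∷_) m
  ... | _ , _ , refl = shortened≢ a r (≤-<-trans z≤n (<ᵇ⇒< (head0 r) a (true⇒T lt)))

part-++ˡ : ∀ xs ys j → j < length xs → part (xs ++ ys) j ≡ part xs j
part-++ˡ (_ ∷ _)  _ zero    _        = refl
part-++ˡ (_ ∷ xs) ys (suc j) (s≤s j<) = part-++ˡ xs ys j j<

part-snoc : ∀ xs y → part (xs ++ y ∷ []) (length xs) ≡ y
part-snoc []       _ = refl
part-snoc (_ ∷ xs) y = part-snoc xs y

part-beyond : ∀ xs j → length xs ≤ j → part xs j ≡ 0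
part-beyond []       _       _        = refl
part-beyond (_ ∷ xs) (suc j) (s≤s le) = part-beyond xs j le

length-oneTo : ∀ m → length (oneTo m) ≡ m
length-oneTo zero    = refl
length-oneTo (suc m) =
  trans (length-++ (oneTo m)) (trans (+-comm (length (oneTo m)) 1) (cong suc (length-oneTo m)))

length-tabulate : ∀ (f : ℕ → ℕ) m → length (map f (oneTo m)) ≡ m
length-tabulate f m = trans (length-map f (oneTo m)) (length-oneTo m)

part-tabulate : ∀ (f : ℕ → ℕ) m j → j < m → part (map f (oneTo m)) j ≡ f (suc j)
part-tabulate f (suc m) j j<1+m
  rewrite map-++ f (oneTo m) (suc m ∷ []) with m≤n⇒m<n∨m≡n (≤-pred j<1+m)
... | inj₁ j<m =
  trans (part-++ˡ (map f (oneTo m)) _ j (subst (j <_) (sym (length-tabulate f m)) j<m))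
        (part-tabulate f m j j<m)
... | inj₂ refl =
  subst (λ k → part (map f (oneTo j) ++ f (suc j) ∷ []) k ≡ f (suc j))
        (length-tabulate f j) (part-snoc (map f (oneTo j)) (f (suc j)))

colLen : ℕ → List ℕ → ℕ
colLen i l = length (filter (i ≤?_) l)

colLen-≤ : ∀ i a r → i ≤ a → colLen i (a ∷ r) ≡ suc (colLen i r)
colLen-≤ i a r i≤a = cong length (filter-accept (i ≤?_) i≤a)

colLen-> : ∀ i a r → a < i → colLen i (a ∷ r) ≡ colLen i r
colLen-> i a r a<i = cong length (filter-reject (i ≤?_) (<⇒≱ a<i))

colLen-empty : ∀ i r → (∀ k → part r k < i) → colLen i r ≡ 0
colLen-empty i []      _ = refl
colLen-empty i (a ∷ r) h = trans (colLen-> i a r (h 0)) (colLen-empty i r (λ k → h (suc k)))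

part-conj : ∀ l j → j < head0 l → part (conj l) j ≡ colLen (suc j) l
part-conj l = part-tabulate (λ i → colLen i l) (head0 l)

part-conj-beyond : ∀ l j → head0 l ≤ j → part (conj l) j ≡ 0
part-conj-beyond l j le =
  part-beyond (conj l) j (subst (_≤ j) (sym (length-tabulate (λ i → colLen i l) (head0 l))) le)

colLen⇒ : ∀ l → IsPart l → ∀ i j → i < colLen (suc j) l → j < part l i
colLen⇒ (a ∷ r) p i j i< with suc j ≤? a
... | yes j<a = row i (subst (i <_) (colLen-≤ (suc j) a r j<a) i<)
  where
  row : ∀ i → i < suc (colLen (suc j) r) → j < part (a ∷ r) i
  row zero    _        = j<a
  row (suc i) (s≤s i<) = colLen⇒ r (IsPart-tail p) i j i<
... | no j≮a =
  ⊥-elim (<-irrefl (sym empty) (≤-<-trans z≤n (subst (i <_) (colLen-> (suc j) a r a≤j) i<)))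
  where
  a≤j = ≰⇒> j≮a
  empty : colLen (suc j) r ≡ 0
  empty = colLen-empty (suc j) r (λ k → ≤-<-trans (part≤head p (suc k)) a≤j)

colLen⇐ : ∀ l → IsPart l → ∀ i j → j < part l i → i < colLen (suc j) l
colLen⇐ (a ∷ r) p zero    j j<a = subst (0 <_) (sym (colLen-≤ (suc j) a r j<a)) (s≤s z≤n)
colLen⇐ (a ∷ r) p (suc i) j j<  =
  subst (suc i <_) (sym (colLen-≤ (suc j) a r (≤-trans j< (part≤head p (suc i)))))
        (s≤s (colLen⇐ r (IsPart-tail p) i j j<))

conj-cell⇒ : ∀ l → IsPart l → ∀ i j → i < part (conj l) j → j < part l i
conj-cell⇒ l p i j i< with j <? head0 l
... | yes j<h = colLen⇒ l p i j (subst (i <_) (part-conj l j j<h) i<)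
... | no j≮h  = ⊥-elim (<-irrefl (sym (part-conj-beyond l j (≮⇒≥ j≮h))) (≤-<-trans z≤n i<))

conj-cell⇐ : ∀ l → IsPart l → ∀ i j → j < part l i → i < part (conj l) j
conj-cell⇐ l p i j j< =
  subst (i <_) (sym (part-conj l j (<-≤-trans j< (part≤head p i)))) (colLen⇐ l p i j j<)

IsPart-conj : ∀ l → IsPart l → IsPart (conj l)
IsPart-conj l p = record { decreasing = dec ; positive = pos }
  where
  dec : ∀ j → part (conj l) (suc j) ≤ part (conj l) j
  dec j = ≤-by-elements _ _ (λ i i< →
    conj-cell⇐ l p i j (<-trans (n<1+n j) (conj-cell⇒ l p i (suc j) i<)))
  pos : ∀ j → j < length (conj l) → 0 < part (conj l) j
  pos j j< = conj-cell⇐ l p 0 j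
    (subst (j <_) (trans (length-tabulate (λ i → colLen i l) (head0 l)) (sym (part-zero l))) j<)

conj-⊆ : ∀ x y → IsPart x → IsPart y → T (contained x y) → T (contained (conj x) (conj y))
conj-⊆ x y px py x⊆y = ≤⇒contained (conj x) (conj y) (λ j → ≤-by-elements _ _ (λ i i< →
  conj-cell⇐ y py i j (<-≤-trans (conj-cell⇒ x px i j i<) (contained⇒≤ x y x⊆y i))))

conj-⊆⁻ : ∀ x y → IsPart x → IsPart y → T (contained (conj x) (conj y)) → T (contained x y)
conj-⊆⁻ x y px py c = ≤⇒contained x y (λ i → ≤-by-elements _ _ (λ j j< →
  conj-cell⇒ y py i j (<-≤-trans (conj-cell⇐ x px i j j<) (contained⇒≤ (conj x) (conj y) c j))))

contained-conj : ∀ x y → IsPart x → IsPart y → contained (conj x) (conj y) ≡ contained x y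
contained-conj x y px py = T-ext (conj-⊆⁻ x y px py) (conj-⊆ x y px py)

conj-involutive : ∀ l → IsPart l → conj (conj l) ≡ l
conj-involutive l p = part-ext (conj (conj l)) l (IsPart-conj (conj l) pc) p (λ i → ≤-antisym
  (≤-by-elements _ _ (λ j j< → conj-cell⇒ l p i j (conj-cell⇒ (conj l) pc j i j<)))
  (≤-by-elements _ _ (λ j j< → conj-cell⇐ (conj l) pc j i (conj-cell⇐ l p i j j<))))
  where pc = IsPart-conj l p

conj-injective : ∀ x y → IsPart x → IsPart y → conj x ≡ conj y → x ≡ y
conj-injective x y px py e =
  trans (sym (conj-involutive x px)) (trans (cong conj e) (conj-involutive y py))

Σ₁ : (ℕ → ℕ) → ℕ → ℕ
Σ₁ f m = sum (map f (oneTo m))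

Σ₁-suc : ∀ f m → Σ₁ f (suc m) ≡ Σ₁ f m + f (suc m)
Σ₁-suc f m = trans (cong sum (map-++ f (oneTo m) (suc m ∷ [])))
  (trans (sum-++ (map f (oneTo m)) _) (cong (Σ₁ f m +_) (+-identityʳ _)))

Σ₁-cong : ∀ f g m → (∀ i → i ≤ m → f i ≡ g i) → Σ₁ f m ≡ Σ₁ g m
Σ₁-cong f g zero    _ = refl
Σ₁-cong f g (suc m) h = begin
  Σ₁ f (suc m)           ≡⟨ Σ₁-suc f m ⟩
  Σ₁ f m + f (suc m)     ≡⟨ cong₂ _+_ (Σ₁-cong f g m (λ i i≤m → h i (m≤n⇒m≤1+n i≤m)))
                                      (h (suc m) ≤-refl) ⟩
  Σ₁ g m + g (suc m)     ≡⟨ Σ₁-suc g m ⟨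
  Σ₁ g (suc m)           ∎
  where open ≡-Reasoning

Σ₁-vanish : ∀ f k m → k ≤ m → (∀ i → k < i → f i ≡ 0) → Σ₁ f m ≡ Σ₁ f k
Σ₁-vanish f k m k≤m h with m≤n⇒∃[o]m+o≡n k≤m
... | o , refl = extra o
  where
  extra : ∀ o → Σ₁ f (k + o) ≡ Σ₁ f k
  extra zero    = cong (Σ₁ f) (+-identityʳ k)
  extra (suc o) = begin
    Σ₁ f (k + suc o)               ≡⟨ cong (Σ₁ f) (+-suc k o) ⟩
    Σ₁ f (suc (k + o))             ≡⟨ Σ₁-suc f (k + o) ⟩
    Σ₁ f (k + o) + f (suc (k + o)) ≡⟨ cong₂ _+_ (extra o) (h (suc (k + o)) (s≤s (m≤m+n k o))) ⟩
    Σ₁ f k + 0                     ≡⟨ +-identityʳ _ ⟩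
    Σ₁ f k                         ∎
    where open ≡-Reasoning

-- Conjugation preserves size: the first row contributes one cell to each of
-- the first a columns, and the remaining rows form the columns of conj r.
size-conj : ∀ l → IsPart l → size (conj l) ≡ size l
size-conj []      _ = refl
size-conj (a ∷ r) p = begin
  Σ₁ (λ i → colLen i (a ∷ r)) a              ≡⟨ Σ₁-cong _ _ a (λ i i≤a → colLen-≤ i a r i≤a) ⟩
  Σ₁ (λ i → 1 + colLen i r) a                ≡⟨ sum-map-+ (λ _ → 1) (λ i → colLen i r) (oneTo a) ⟩
  Σ₁ (λ _ → 1) a + Σ₁ (λ i → colLen i r) a   ≡⟨ cong₂ _+_ ones lower-rows ⟩
  a + size (conj r)                          ≡⟨ cong (a +_) (size-conj r (IsPart-tail p)) ⟩
  a + size r                                 ∎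
  where
  open ≡-Reasoning
  ones : Σ₁ (λ _ → 1) a ≡ a
  ones = trans (sum-map-1 (oneTo a)) (length-oneTo a)
  lower-rows : Σ₁ (λ i → colLen i r) a ≡ size (conj r)
  lower-rows = Σ₁-vanish (λ i → colLen i r) (head0 r) a
    (subst (_≤ a) (part-zero r) (part≤head p 1))
    (λ i h<i → colLen-empty i r (λ k → ≤-<-trans (part≤head (IsPart-tail p) k) h<i))

eqL-conj : ∀ x y → IsPart x → IsPart y → eqL (conj x) (conj y) ≡ eqL x y
eqL-conj x y px py = T-ext
  (λ t → subst (λ z → T (eqL x z)) (conj-injective x y px py (eqL⇒≡ (conj x) (conj y) t)) (eqL-refl x))
  (λ t → subst (λ z → T (eqL (conj x) (conj z))) (eqL⇒≡ x y t) (eqL-refl (conj x)))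

⋖-conj : ∀ {κ l} → IsPart l → κ ⋖ l → conj κ ⋖ conj l
⋖-conj {κ} {l} p (covered q κ⊆l e) = covered (IsPart-conj κ q) (conj-⊆ κ l q p κ⊆l)
  (trans (size-conj l p) (trans e (cong suc (sym (size-conj κ q)))))

removals-conj : ∀ l → IsPart l → removals (conj l) ↭ map conj (removals l)
removals-conj l p = ∼bag⇒↭ (unique∧set⇒bag (removals-unique (conj l)) conj-unique (mk⇔ to from))
  where
  pc = IsPart-conj l p
  conj-unique : Unique (map conj (removals l))
  conj-unique = Unique.map⁻ (subst Unique (sym twice) (removals-unique l))
    where
    twice : map conj (map conj (removals l)) ≡ removals l
    twice = trans (sym (map-∘ (removals l))) (map-id-local (All.tabulate (λ m →
      conj-involutive _ (_⋖_.isPart (removals-sound l p m)))))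
  to : ∀ {x} → x ∈ removals (conj l) → x ∈ map conj (removals l)
  to {x} m = subst (_∈ map conj (removals l)) (conj-involutive x (_⋖_.isPart x⋖))
    (∈-map⁺ conj (removals-complete l p (subst (conj x ⋖_) (conj-involutive l p) (⋖-conj pc x⋖))))
    where x⋖ = removals-sound (conj l) pc m
  from : ∀ {x} → x ∈ map conj (removals l) → x ∈ removals (conj l)
  from m with ∈-map⁻ conj m
  ... | κ , mκ , refl = removals-complete (conj l) pc (⋖-conj p (removals-sound l p mκ))

descend : ℕ → List ℕ → List ℕ → ℕ
descend f μ ν = if contained μ ν then sytFuel f ν μ else 0

sytFuel-done : ∀ f l μ → eqL l μ ≡ true → sytFuel f l μ ≡ 1
sytFuel-done f l μ e with eqL l μ
sytFuel-done f l μ refl | .true = refl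

sytFuel-empty : ∀ l μ → eqL l μ ≡ false → sytFuel 0 l μ ≡ 0
sytFuel-empty l μ e with eqL l μ
sytFuel-empty l μ refl | .false = refl

sytFuel-step : ∀ f l μ → eqL l μ ≡ false → sytFuel (suc f) l μ ≡ sum (map (descend f μ) (removals l))
sytFuel-step f l μ e with eqL l μ
sytFuel-step f l μ refl | .false = refl

-- Chain counts are invariant under conjugating both ends: conjugation is an
-- automorphism of Young's lattice, so it permutes the removals (removals-conj).
sytFuel-conj : ∀ f l μ → size l ≡ f → IsPart l → IsPart μ →
  sytFuel f (conj l) (conj μ) ≡ sytFuel f l μ
sytFuel-conj f l μ sl pl pμ = by-cases (eqL l μ) refl
  where
  same : eqL (conj l) (conj μ) ≡ eqL l μ
  same = eqL-conj l μ pl pμ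
  unfolded : ∀ g → size l ≡ g → eqL l μ ≡ false → sytFuel g (conj l) (conj μ) ≡ sytFuel g l μ
  unfolded zero    _  e =
    trans (sytFuel-empty (conj l) (conj μ) (trans same e)) (sym (sytFuel-empty l μ e))
  unfolded (suc g) sl e = begin
    sytFuel (suc g) (conj l) (conj μ)
      ≡⟨ sytFuel-step g (conj l) (conj μ) (trans same e) ⟩
    sum (map (descend g (conj μ)) (removals (conj l)))
      ≡⟨ sum-↭ (Perm.map⁺ (descend g (conj μ)) (removals-conj l pl)) ⟩
    sum (map (descend g (conj μ)) (map conj (removals l)))
      ≡⟨ cong sum (map-∘ (removals l)) ⟨
    sum (map (descend g (conj μ) ∘ conj) (removals l))
      ≡⟨ cong sum (map-cong-local (All.tabulate summand)) ⟩
    sum (map (descend g μ) (removals l))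
      ≡⟨ sytFuel-step g l μ e ⟨
    sytFuel (suc g) l μ
      ∎
    where
    open ≡-Reasoning
    summand : ∀ {κ} → κ ∈ removals l → descend g (conj μ) (conj κ) ≡ descend g μ κ
    summand {κ} m with removals-sound l pl m
    ... | covered q _ sκ = cong₂ (λ b n → if b then n else 0) (contained-conj μ κ pμ q)
      (sytFuel-conj g κ μ (suc-injective (trans (sym sκ) sl)) q pμ)
  by-cases : ∀ b → eqL l μ ≡ b → sytFuel f (conj l) (conj μ) ≡ sytFuel f l μ
  by-cases true  e = trans (sytFuel-done f (conj l) (conj μ) (trans same e)) (sym (sytFuel-done f l μ e))
  by-cases false e = unfolded f sl e

N-conj : ∀ l μ → IsPart l → IsPart μ → N (conj l) (conj μ) ≡ N l μ
N-conj l μ pl pμ =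
  trans (cong (λ f → sytFuel f (conj l) (conj μ)) (size-conj l pl)) (sytFuel-conj (size l) l μ refl pl pμ)

skew : List ℕ → List ℕ → ℕ
skew l ν = if contained ν l then N l ν else 0

skew-conj : ∀ l ν → IsPart l → IsPart ν → skew (conj l) (conj ν) ≡ skew l ν
skew-conj l ν pl pν = cong₂ (λ b n → if b then n else 0) (contained-conj ν l pν pl) (N-conj l ν pl pν)

Branching : ℕ → (List ℕ → ℕ) → Set
Branching m F = ∀ l → IsPart l → m < size l → F l ≡ sum (map F (removals l))

branching-+ : ∀ m F H → Branching m F → Branching m H → Branching m (λ l → F l + H l)
branching-+ m F H bF bH l p m<l =
  trans (cong₂ _+_ (bF l p m<l) (bH l p m<l)) (sym (sum-map-+ F H (removals l)))

-- Removing the cell containing the largest entry of a tableau of shape l/ν: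
-- skew l ν is the sum of skew κ ν over the removals κ of l, whenever |ν| < |l|.
skew-branching : ∀ m ν → size ν ≤ m → Branching m (λ l → skew l ν)
skew-branching m ν ν≤m l p m<l with m≤n⇒∃[o]m+o≡n m<l
... | o , sl = unfold (m + o) (sym sl)
  where
  ν≢l : eqL l ν ≡ false
  ν≢l = T-ext (λ t → <-irrefl (cong size (sym (eqL⇒≡ l ν t))) (≤-<-trans ν≤m m<l)) (λ ())
  unfold : ∀ s → size l ≡ suc s → skew l ν ≡ sum (map (λ κ → skew κ ν) (removals l))
  unfold s sl with contained ν l in ν⊆l
  -- ν ⊆ l: unfold N l ν once; each summand is skew κ ν since |κ| = s.
  ... | true = trans (cong (λ f → sytFuel f l ν) sl)
    (trans (sytFuel-step s l ν ν≢l) (cong sum (map-cong-local (All.tabulate summand))))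
    where
    summand : ∀ {κ} → κ ∈ removals l → descend s ν κ ≡ skew κ ν
    summand {κ} mem with removals-sound l p mem
    ... | covered _ _ sκ = cong (λ f → if contained ν κ then sytFuel f κ ν else 0)
                                (suc-injective (trans (sym sl) sκ))
  -- ν ⊄ l: then ν ⊄ κ for every removal κ ⊆ l, so both sides vanish.
  ... | false = sym (trans (cong sum (map-cong-local (All.tabulate summand))) (sum-map-0 (removals l)))
    where
    summand : ∀ {κ} → κ ∈ removals l → skew κ ν ≡ 0
    summand {κ} mem with contained ν κ in ν⊆κ
    ... | false = refl
    ... | true  = ⊥-elim (subst T ν⊆l (contained-trans ν κ l (true⇒T ν⊆κ)
                                                          (_⋖_.⊆-upper (removals-sound l p mem))))

agree-above : ∀ m F H → Branching m F → Branching m H →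
  (∀ l → IsPart l → size l ≡ m → F l ≡ H l) → ∀ l → IsPart l → m ≤ size l → F l ≡ H l
agree-above m F H bF bH base l p m≤l with m≤n⇒∃[o]m+o≡n m≤l
... | t , sl = by-level t l p (sym sl)
  where
  by-level : ∀ t l → IsPart l → size l ≡ m + t → F l ≡ H l
  by-level zero    l p sl = base l p (trans sl (+-identityʳ m))
  by-level (suc t) l p sl = begin
    F l                      ≡⟨ bF l p m<l ⟩
    sum (map F (removals l)) ≡⟨ cong sum (map-cong-local (All.tabulate below)) ⟩
    sum (map H (removals l)) ≡⟨ bH l p m<l ⟨
    H l                      ∎
    where
    open ≡-Reasoning
    m<l : m < size l
    m<l = subst (m <_) (sym sl) (m<m+n m (s≤s z≤n))
    below : ∀ {κ} → κ ∈ removals l → F κ ≡ H κ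
    below mem with removals-sound l p mem
    ... | covered q _ sκ = by-level t _ q (suc-injective (trans (sym sκ) (trans sl (+-suc m t))))

isPartition-tail : ∀ a r → T (isPartition (a ∷ r)) → T (isPartition r)
isPartition-tail a []      _ = tt
isPartition-tail a (b ∷ r) t = proj₂ (∧-elim t)

zero-part : ∀ xs r → ¬ T (isPartition (xs ++ 0 ∷ r))
zero-part []       []          ()
zero-part []       (zero ∷ r)  t = zero-part [] r (proj₂ (∧-elim t))
zero-part []       (suc _ ∷ _) ()
zero-part (x ∷ xs) r           t = zero-part xs r (isPartition-tail x (xs ++ 0 ∷ r) t)

[2] [1,1] [3] [2,1] [1,1,1] : List ℕ
[2]     = 2 ∷ []
[1,1]   = 1 ∷ 1 ∷ []
[3]     = 3 ∷ []
[2,1]   = 2 ∷ 1 ∷ []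
[1,1,1] = 1 ∷ 1 ∷ 1 ∷ []

partitions-of-2 : ∀ μ → T (isPartition μ) → size μ ≡ 2 → μ ≡ [2] ⊎ μ ≡ [1,1]
partitions-of-2 (1 ∷ 1 ∷ [])            _ _  = inj₂ refl
partitions-of-2 (2 ∷ [])                _ _  = inj₁ refl
partitions-of-2 (0 ∷ r)                 t _  = ⊥-elim (zero-part [] r t)
partitions-of-2 (1 ∷ 0 ∷ r)             t _  = ⊥-elim (zero-part (1 ∷ []) r t)
partitions-of-2 (1 ∷ 1 ∷ 0 ∷ r)         t _  = ⊥-elim (zero-part (1 ∷ 1 ∷ []) r t)
partitions-of-2 (2 ∷ 0 ∷ r)             t _  = ⊥-elim (zero-part (2 ∷ []) r t)
partitions-of-2 []                      _ ()
partitions-of-2 (1 ∷ [])                _ ()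
partitions-of-2 (1 ∷ 1 ∷ suc _ ∷ _)     _ ()
partitions-of-2 (1 ∷ suc (suc _) ∷ _)   _ ()
partitions-of-2 (2 ∷ suc _ ∷ _)         _ ()
partitions-of-2 (suc (suc (suc _)) ∷ _) _ ()

partitions-of-3 : ∀ μ → T (isPartition μ) → size μ ≡ 3 → μ ≡ [3] ⊎ μ ≡ [2,1] ⊎ μ ≡ [1,1,1]
partitions-of-3 (3 ∷ [])                    _ _  = inj₁ refl
partitions-of-3 (2 ∷ 1 ∷ [])                _ _  = inj₂ (inj₁ refl)
partitions-of-3 (1 ∷ 1 ∷ 1 ∷ [])            _ _  = inj₂ (inj₂ refl)
partitions-of-3 (0 ∷ r)                     t _  = ⊥-elim (zero-part [] r t)
partitions-of-3 (1 ∷ 0 ∷ r)                 t _  = ⊥-elim (zero-part (1 ∷ []) r t)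
partitions-of-3 (1 ∷ 1 ∷ 0 ∷ r)             t _  = ⊥-elim (zero-part (1 ∷ 1 ∷ []) r t)
partitions-of-3 (1 ∷ 1 ∷ 1 ∷ 0 ∷ r)         t _  = ⊥-elim (zero-part (1 ∷ 1 ∷ 1 ∷ []) r t)
partitions-of-3 (2 ∷ 0 ∷ r)                 t _  = ⊥-elim (zero-part (2 ∷ []) r t)
partitions-of-3 (2 ∷ 1 ∷ 0 ∷ r)             t _  = ⊥-elim (zero-part (2 ∷ 1 ∷ []) r t)
partitions-of-3 (3 ∷ 0 ∷ r)                 t _  = ⊥-elim (zero-part (3 ∷ []) r t)
partitions-of-3 (1 ∷ 2 ∷ _)                 () _
partitions-of-3 []                          _ ()
partitions-of-3 (1 ∷ [])                    _ ()
partitions-of-3 (1 ∷ 1 ∷ [])                _ ()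
partitions-of-3 (1 ∷ 1 ∷ 1 ∷ suc _ ∷ _)     _ ()
partitions-of-3 (1 ∷ 1 ∷ suc (suc _) ∷ _)   _ ()
partitions-of-3 (1 ∷ suc (suc (suc _)) ∷ _) _ ()
partitions-of-3 (2 ∷ [])                    _ ()
partitions-of-3 (2 ∷ 1 ∷ suc _ ∷ _)         _ ()
partitions-of-3 (2 ∷ suc (suc _) ∷ _)       _ ()
partitions-of-3 (3 ∷ suc _ ∷ _)             _ ()
partitions-of-3 (suc (suc (suc (suc _))) ∷ _) _ ()

on-partitions-of-3 : (P : List ℕ → Set) → P [3] → P [2,1] → P [1,1,1] →
  ∀ l → IsPart l → size l ≡ 3 → P l
on-partitions-of-3 P p₃ p₂₁ p₁₁₁ l p sl with partitions-of-3 l (IsPart⇒isPartition l p) sl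
... | inj₁ refl        = p₃
... | inj₂ (inj₁ refl) = p₂₁
... | inj₂ (inj₂ refl) = p₁₁₁

skew-relation-lift : ∀ m μ ν₁ ν₂ → size μ ≤ m → size ν₁ ≤ m → size ν₂ ≤ m →
  (∀ l → IsPart l → size l ≡ m → skew l μ ≡ skew l ν₁ + skew l ν₂) →
  ∀ l → IsPart l → m ≤ size l → skew l μ ≡ skew l ν₁ + skew l ν₂
skew-relation-lift m μ ν₁ ν₂ μ≤m ν₁≤m ν₂≤m = agree-above m _ _ (skew-branching m μ μ≤m)
  (branching-+ m _ _ (skew-branching m ν₁ ν₁≤m) (skew-branching m ν₂ ν₂≤m))

skew-[2] : ∀ l → IsPart l → 3 ≤ size l → skew l [2] ≡ skew l [3] + skew l [2,1]
skew-[2] = skew-relation-lift 3 [2] [3] [2,1] (n≤1+n 2) ≤-refl ≤-refl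
  (on-partitions-of-3 (λ l → skew l [2] ≡ skew l [3] + skew l [2,1]) refl refl refl)

skew-[1,1] : ∀ l → IsPart l → 3 ≤ size l → skew l [1,1] ≡ skew l [2,1] + skew l [1,1,1]
skew-[1,1] = skew-relation-lift 3 [1,1] [2,1] [1,1,1] (n≤1+n 2) ≤-refl ≤-refl
  (on-partitions-of-3 (λ l → skew l [1,1] ≡ skew l [2,1] + skew l [1,1,1]) refl refl refl)

minorsOfSize : ℕ → List ℕ → List ℕ → ℕ
minorsOfSize t l μ = if isPartition μ ∧ (size μ ≡ᵇ t) ∧ contained μ l then N l μ else 0

SameMinors : ℕ → List ℕ → List ℕ → Set
SameMinors t l ρ = ∀ μ → minorsOfSize t l μ ≡ minorsOfSize t ρ μ

MinorsEq⇔SameMinors : ∀ k n t l ρ → size l ≡ n → size ρ ≡ n → n ∸ k ≡ t →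
  MinorsEq k l ρ ⇔ SameMinors t l ρ
MinorsEq⇔SameMinors k n t l ρ sl sρ e = mk⇔
  (λ M μ → trans (sym (at l sl μ)) (trans (M μ) (at ρ sρ μ)))
  (λ S μ → trans (at l sl μ) (trans (S μ) (sym (at ρ sρ μ))))
  where
  at : ∀ x → size x ≡ n → ∀ μ → minorMult k x μ ≡ minorsOfSize t x μ
  at x sx μ = cong (λ z → minorsOfSize z x μ) (trans (cong (_∸ k) sx) e)

SameMinors-2 : ∀ l ρ → SameMinors 2 l ρ ⇔ (skew l [2] ≡ skew ρ [2] × skew l [1,1] ≡ skew ρ [1,1])
SameMinors-2 l ρ = mk⇔ (λ S → S [2] , S [1,1]) from
  where
  from : skew l [2] ≡ skew ρ [2] × skew l [1,1] ≡ skew ρ [1,1] → SameMinors 2 l ρ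
  from (e₂ , e₁₁) μ with isPartition μ in isP
  ... | false = refl
  ... | true with size μ ≡ᵇ 2 in s≡2
  ...   | false = refl
  ...   | true with partitions-of-2 μ (true⇒T isP) (≡ᵇ⇒≡ (size μ) 2 (true⇒T s≡2))
  ...     | inj₁ refl = e₂
  ...     | inj₂ refl = e₁₁

SameMinors-3 : ∀ l ρ → SameMinors 3 l ρ ⇔
  (skew l [3] ≡ skew ρ [3] × skew l [2,1] ≡ skew ρ [2,1] × skew l [1,1,1] ≡ skew ρ [1,1,1])
SameMinors-3 l ρ = mk⇔ (λ S → S [3] , S [2,1] , S [1,1,1]) from
  where
  from : skew l [3] ≡ skew ρ [3] × skew l [2,1] ≡ skew ρ [2,1] × skew l [1,1,1] ≡ skew ρ [1,1,1] →
         SameMinors 3 l ρ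
  from (e₃ , e₂₁ , e₁₁₁) μ with isPartition μ in isP
  ... | false = refl
  ... | true with size μ ≡ᵇ 3 in s≡3
  ...   | false = refl
  ...   | true with partitions-of-3 μ (true⇒T isP) (≡ᵇ⇒≡ (size μ) 3 (true⇒T s≡3))
  ...     | inj₁ refl        = e₃
  ...     | inj₂ (inj₁ refl) = e₂₁
  ...     | inj₂ (inj₂ refl) = e₁₁₁

module _ (l : List ℕ) (p : IsPart l) where

  private
    g₃ g₂₁ g₁₁₁ : ℕ
    g₃   = skew l [3]
    g₂₁  = skew l [2,1]
    g₁₁₁ = skew l [1,1,1]

    conj-[3] : skew (conj l) [3] ≡ g₁₁₁
    conj-[3] = skew-conj l [1,1,1] p (isPartition⇒IsPart [1,1,1] tt)

    conj-[2,1] : skew (conj l) [2,1] ≡ g₂₁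
    conj-[2,1] = skew-conj l [2,1] p (isPartition⇒IsPart [2,1] tt)

    conj-[1,1,1] : skew (conj l) [1,1,1] ≡ g₃
    conj-[1,1,1] = skew-conj l [3] p (isPartition⇒IsPart [3] tt)

  criterion-3 : SameMinors 3 l (conj l) ⇔ (g₃ ≡ g₁₁₁)
  criterion-3 = ⇔-trans (SameMinors-3 l (conj l)) (mk⇔
    (λ (e₃ , _ , _) → trans e₃ conj-[3])
    (λ e → trans e (sym conj-[3]) , sym conj-[2,1] , trans (sym e) (sym conj-[1,1,1])))

  criterion-2 : 3 ≤ size l → SameMinors 2 l (conj l) ⇔ (g₃ ≡ g₁₁₁)
  criterion-2 3≤l = ⇔-trans (SameMinors-2 l (conj l)) (mk⇔
    (λ (e₂ , _) → +-cancelʳ-≡ g₂₁ g₃ g₁₁₁ (trans (sym row) (trans e₂ rowᵗ)))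
    (λ e → trans row (trans (cong (_+ g₂₁) e) (sym rowᵗ))
         , trans column (trans (cong (g₂₁ +_) (sym e)) (sym columnᵗ))))
    where
    pᵗ   = IsPart-conj l p
    3≤lᵗ = subst (3 ≤_) (sym (size-conj l p)) 3≤l
    row : skew l [2] ≡ g₃ + g₂₁
    row = skew-[2] l p 3≤l
    column : skew l [1,1] ≡ g₂₁ + g₁₁₁
    column = skew-[1,1] l p 3≤l
    rowᵗ : skew (conj l) [2] ≡ g₁₁₁ + g₂₁
    rowᵗ = trans (skew-[2] (conj l) pᵗ 3≤lᵗ) (cong₂ _+_ conj-[3] conj-[2,1])
    columnᵗ : skew (conj l) [1,1] ≡ g₂₁ + g₃
    columnᵗ = trans (skew-[1,1] (conj l) pᵗ 3≤lᵗ) (cong₂ _+_ conj-[2,1] conj-[1,1,1])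

lemma6p4 : (n : ℕ) (λ′ : List ℕ) → isPartition λ′ ≡ true → size λ′ ≡ n → 3 ≤ n →
    (MinorsEq (n ∸ 2) λ′ (conj λ′) ⇔ MinorsEq (n ∸ 3) λ′ (conj λ′))
lemma6p4 n λ′ isP sλ 3≤n =
  ⇔-trans (MinorsEq⇔SameMinors (n ∸ 2) n 2 λ′ (conj λ′) sλ sλᵗ (m∸[m∸n]≡n 2≤n))
  (⇔-trans (criterion-2 λ′ p (subst (3 ≤_) (sym sλ) 3≤n))
  (⇔-sym (⇔-trans (MinorsEq⇔SameMinors (n ∸ 3) n 3 λ′ (conj λ′) sλ sλᵗ (m∸[m∸n]≡n 3≤n))
                  (criterion-3 λ′ p))))
  where
  p   = isPartition⇒IsPart λ′ (true⇒T isP)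
  sλᵗ = trans (size-conj λ′ p) sλ
  2≤n = ≤-trans (n≤1+n 2) 3≤n
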